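{- Let $t\geq 1$ and let $G$ be a graph with the $t$-cleavage property. Let $T$ be the bipartite graph whose vertex classes are the set of $(t+1)$-blocks of $G$ and the set of $t$-vertex separators of $G$, in which a $(t+1)$-block $D$ and a $t$-vertex separator $X$ are adjacent if and only if $X\subseteq V(D)$. Then $T$ is a tree.
   Context: A $t$-vertex separator of a connected graph $G$ is a set $X\subseteq V(G)$ with $|X|=t$ such that $G-X$ is disconnected. $G$ has the $t$-cleavage property if $G$ is $t$-connected and every $t$-vertex separator of $G$ induces a complete subgraph (clique) of $G$. A $(t+1)$-block of such a $G$ is a subgraph $D$ which is either isomorphic to $K_{t+1}$ or $(t+1)$-connected, and which is maximal with respect to inclusion subject to this condition. -}

module Defs where

open import Data.Nat using (ℕ; suc; _≤_; _<_)
open import Data.Fin using (Fin)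
open import Data.Fin.Subset using (Subset; _∈_; _∉_; _⊆_; _─_; ∣_∣)
open import Data.Bool using (Bool; true)
open import Data.Vec using (Vec; lookup)
open import Data.List using (List; []; _∷_; _++_; length)
open import Data.List.Relation.Unary.All using (All)
open import Data.List.Relation.Unary.Unique.Propositional using (Unique)
open import Data.Product using (Σ; ∃; _×_; _,_)
open import Data.Sum using (_⊎_; inj₁; inj₂)
open import Data.Unit using (⊤)
open import Data.Empty using (⊥)
open import Relation.Nullary using (¬_)
open import Relation.Binary.PropositionalEquality using (_≡_; _≢_)

data Walk {A : Set} (P : A → Set) (R : A → A → Set) : A → A → Set where
  stop : ∀ {x} → P x → Walk P R x x
  step : ∀ {x y z} → P x → R x y → Walk P R y z → Walk P R x z

Chain : {A : Set} → (A → A → Set) → List A → Set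
Chain R []           = ⊤
Chain R (x ∷ [])     = ⊤
Chain R (x ∷ y ∷ zs) = R x y × Chain R (y ∷ zs)

Cycle : {A : Set} → (A → Set) → (A → A → Set) → Set
Cycle {A} P R = Σ A λ x → Σ (List A) λ ys →
  (2 ≤ length ys) × All P (x ∷ ys) × Unique (x ∷ ys) × Chain R (x ∷ ys ++ x ∷ [])

IsTree : {A : Set} → (A → Set) → (A → A → Set) → Set
IsTree {A} P R =
  (∃ λ x → P x) ×
  (∀ x y → P x → P y → Walk P R x y) ×
  ¬ Cycle P R

record SubG (n : ℕ) : Set where
  constructor subG
  field
    V : Subset n
    E : Vec (Vec Bool n) n

open SubG public

Adj : ∀ {n} → SubG n → Fin n → Fin n → Set
Adj H u v = lookup (lookup (E H) u) v ≡ true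

WellFormed : ∀ {n} → SubG n → Set
WellFormed H =
  (∀ u v → Adj H u v → (u ∈ V H) × (v ∈ V H)) ×
  (∀ u v → Adj H u v → Adj H v u) ×
  (∀ u → ¬ Adj H u u)

Spanning : ∀ {n} → SubG n → Set
Spanning H = ∀ u → u ∈ V H

_≼_ : ∀ {n} → SubG n → SubG n → Set
D ≼ H = WellFormed D × (V D ⊆ V H) × (∀ u v → Adj D u v → Adj H u v)

ConnectedOn : ∀ {n} → SubG n → Subset n → Set
ConnectedOn H S = ∀ u v → u ∈ S → v ∈ S → Walk (_∈ S) (Adj H) u v

DisconnectedOn : ∀ {n} → SubG n → Subset n → Set
DisconnectedOn H S = Σ _ λ u → Σ _ λ v →
  (u ∈ S) × (v ∈ S) × ¬ Walk (_∈ S) (Adj H) u v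

Connected : ∀ {n} → ℕ → SubG n → Set
Connected k H =
  (k < ∣ V H ∣) ×
  (∀ X → X ⊆ V H → ∣ X ∣ < k → ConnectedOn H (V H ─ X))

Separator : ∀ {n} → ℕ → SubG n → Subset n → Set
Separator t H X = (X ⊆ V H) × (∣ X ∣ ≡ t) × DisconnectedOn H (V H ─ X)

Clique : ∀ {n} → SubG n → Subset n → Set
Clique H X = ∀ u v → u ∈ X → v ∈ X → u ≢ v → Adj H u v

Cleavage : ∀ {n} → ℕ → SubG n → Set
Cleavage t G = Connected t G × (∀ X → Separator t G X → Clique G X)

IsComplete : ∀ {n} → ℕ → SubG n → Set
IsComplete m H = (∣ V H ∣ ≡ m) ×
  (∀ u v → u ∈ V H → v ∈ V H → u ≢ v → Adj H u v)

BlockCandidate : ∀ {n} → ℕ → SubG n → SubG n → Set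
BlockCandidate t G D = (D ≼ G) × (IsComplete (suc t) D ⊎ Connected (suc t) D)

Block : ∀ {n} → ℕ → SubG n → SubG n → Set
Block t G D = BlockCandidate t G D ×
  (∀ D′ → BlockCandidate t G D′ → D ≼ D′ → D ≡ D′)

TVert : ℕ → Set
TVert n = SubG n ⊎ Subset n

InT : ∀ {n} → ℕ → SubG n → TVert n → Set
InT t G (inj₁ D) = Block t G D
InT t G (inj₂ X) = Separator t G X

AdjT : ∀ {n} → TVert n → TVert n → Set
AdjT (inj₁ D) (inj₂ X) = X ⊆ V D
AdjT (inj₂ X) (inj₁ D) = X ⊆ V D
AdjT (inj₁ _) (inj₁ _) = ⊥
AdjT (inj₂ _) (inj₂ _) = ⊥

-- Induction on |V(G)|. If G has no t-separator, G itself is its only (t+1)-block. Otherwise a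
-- t-separator X splits G into two smaller sides, X ∪ C (C a component of G − X) and X together with
-- the remaining components. Since X is a clique, walks of G reroute inside a side, so each side has
-- the t-cleavage property, and every (t+1)-block of G lies in one side and is a block of it. By
-- induction, every clique lies in a block, and two distinct blocks sharing a t-set K make K a
-- separator. Connectivity of T: blocks in different sides are joined through X and blocks of the
-- sides containing X. Acyclicity: a cycle of T passes through a separator X between two distinct
-- blocks; following the cycle away from X, every block stays inside X ∪ C, where C is the component
-- met by the first block. Both blocks are then blocks of the graph induced on X ∪ C, so X separates
-- that graph, impossible since C is connected.

module Submission where

open import Defs
open import Data.Nat using (ℕ; zero; suc; _≤_; _<_; s≤s)
open import Data.Nat.Properties
  using (≤-refl; ≤-trans; <-≤-trans; ≤-reflexive; <⇒≤; <-irrefl; ≤-pred; n≮0; ≤∧≢⇒<; _<?_; ≤-antisym; ≮⇒≥)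
  renaming (_≟_ to _≟ℕ_)
open import Data.Bool using (true; false)
import Data.Bool as Bool
open import Data.Bool.Properties using (⇔→≡)
open import Data.Fin using (Fin)
import Data.Fin as Fin
open import Data.Fin.Properties using (_≟_; any?)
open import Data.Fin.Subset using (Subset; _∈_; _∉_; _⊆_; _─_; _-_; _∩_; ∣_∣; ⊥)
open import Data.Fin.Subset.Properties
  using (_∈?_; _⊆?_; ⊆-antisym; ⊥⊆; ∉⊥; ∣⊥∣≡0; ∣p∣≤n; p⊆q⇒∣p∣≤∣q∣; p⊂q⇒∣p∣<∣q∣;
         x∈p∧x∉q⇒x∈p─q; p─q⊆p; x∈p∩q⁺; x∈p∩q⁻; ∣p∩q∣≤∣p∣; x∉⁅y⁆⇒x≢y; x∈p∧x≢y⇒x∈p-y;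
         x∈p⇒∣p-x∣<∣p∣; anySubset?)
open import Data.Vec using (Vec; _∷_; lookup; tabulate; here; there)
open import Data.Vec.Properties using (lookup∘tabulate; []=⇒lookup; lookup⇒[]=; tabulate∘lookup; tabulate-cong)
open import Data.List using ([]; _∷_; _++_)
open import Data.List.Membership.Propositional using () renaming (_∈_ to _∈ₗ_)
open import Data.List.Relation.Unary.All using (All; []; _∷_)
import Data.List.Relation.Unary.All as All
open import Data.List.Relation.Unary.Any using (here; there)
open import Data.List.Relation.Unary.AllPairs using (_∷_)
open import Data.Product using (∃; _×_; _,_; proj₁; proj₂)
open import Data.Sum using (_⊎_; inj₁; inj₂; [_,_]′)
open import Data.Empty renaming (⊥ to Empty) using (⊥-elim)
open import Function.Bundles using (mk⇔)
open import Relation.Nullary using (¬_; Dec; yes; no; does; _×-dec_; _⊎-dec_; ¬?)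
open import Relation.Nullary.Decidable using (dec-true; decidable-stable)
open import Relation.Binary.PropositionalEquality using (_≡_; _≢_; refl; sym; trans; cong; cong₂; subst)

does⇒witness : {A : Set} (a? : Dec A) → does a? ≡ true → A
does⇒witness (yes a) _  = a
does⇒witness (no _)  ()

x∈p─q⁻ : ∀ {n} {x : Fin n} (p q : Subset n) → x ∈ p ─ q → x ∈ p × x ∉ q
x∈p─q⁻ {x = Fin.zero}  (true ∷ p) (false ∷ q) here = here , λ ()
x∈p─q⁻ {x = Fin.suc x} (_ ∷ p) (_ ∷ q) (there x∈) with x∈p─q⁻ p q x∈
... | x∈p , x∉q = there x∈p , λ { (there x∈q) → x∉q x∈q }

module _ {n : ℕ} where

  fromDec : {P : Fin n → Set} → (∀ i → Dec (P i)) → Subset n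
  fromDec P? = tabulate (λ i → does (P? i))

  module _ {P : Fin n → Set} (P? : ∀ i → Dec (P i)) {i : Fin n} where

    ∈-fromDec⁺ : P i → i ∈ fromDec P?
    ∈-fromDec⁺ p = lookup⇒[]= i _ (trans (lookup∘tabulate _ i) (dec-true (P? i) p))

    ∈-fromDec⁻ : i ∈ fromDec P? → P i
    ∈-fromDec⁻ i∈ = does⇒witness (P? i) (trans (sym (lookup∘tabulate _ i)) ([]=⇒lookup i∈))

  ⊈⇒∃ : (p q : Subset n) → ¬ (p ⊆ q) → ∃ λ x → x ∈ p × x ∉ q
  ⊈⇒∃ p q p⊈q with any? (λ x → x ∈? p ×-dec ¬? (x ∈? q))
  ... | yes w = w
  ... | no ∄ = ⊥-elim (p⊈q λ {x} x∈p → decidable-stable (x ∈? q) λ x∉q → ∄ (x , x∈p , x∉q))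

  p⊆q∧∣q∣≤∣p∣⇒p≡q : {p q : Subset n} → p ⊆ q → ∣ q ∣ ≤ ∣ p ∣ → p ≡ q
  p⊆q∧∣q∣≤∣p∣⇒p≡q {p} {q} p⊆q ∣q∣≤∣p∣ = ⊆-antisym p⊆q q⊆p
    where
    q⊆p : q ⊆ p
    q⊆p {x} x∈q = decidable-stable (x ∈? p) λ x∉p →
      <-irrefl refl (<-≤-trans (p⊂q⇒∣p∣<∣q∣ (p⊆q , x , x∈q , x∉p)) ∣q∣≤∣p∣)

module _ {A : Set} {P : A → Set} {R : A → A → Set} where

  walk-source : ∀ {a b} → Walk P R a b → P a
  walk-source (stop p)     = p
  walk-source (step p _ _) = p

  walk-target : ∀ {a b} → Walk P R a b → P b
  walk-target (stop p)     = p
  walk-target (step _ _ w) = walk-target w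

  infixr 5 _◅◅_

  _◅◅_ : ∀ {a b c} → Walk P R a b → Walk P R b c → Walk P R a c
  stop _     ◅◅ w′ = w′
  step p r w ◅◅ w′ = step p r (w ◅◅ w′)

  walk-snoc : ∀ {a b c} → Walk P R a b → R b c → P c → Walk P R a c
  walk-snoc w r pc = w ◅◅ step (walk-target w) r (stop pc)

  walk-reverse : (∀ {x y} → R x y → R y x) → ∀ {a b} → Walk P R a b → Walk P R b a
  walk-reverse sym-R (stop p)     = stop p
  walk-reverse sym-R (step p r w) = walk-snoc (walk-reverse sym-R w) (sym-R r) p

walk-map : {A : Set} {P Q : A → Set} {R R′ : A → A → Set} →
  (∀ {x} → P x → Q x) → (∀ {x y} → R x y → R′ x y) → ∀ {a b} → Walk P R a b → Walk Q R′ a b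
walk-map f g (stop p)     = stop (f p)
walk-map f g (step p r w) = step (f p) (g r) (walk-map f g w)

-- reached k consists of the vertices within distance k of u; each round either adds a vertex
-- or has reached a closed set, so after n rounds the set is closed.
module Reachability {n : ℕ} (S : Subset n) {R : Fin n → Fin n → Set}
                    (R? : ∀ u v → Dec (R u v)) (u : Fin n) where

  Reach : Fin n → Set
  Reach = Walk (_∈ S) R u

  OneStep : Subset n → Fin n → Set
  OneStep Q v = v ∈ Q ⊎ (v ∈ S × ∃ λ w → w ∈ Q × R w v)

  one-step? : ∀ Q v → Dec (OneStep Q v)
  one-step? Q v = (v ∈? Q) ⊎-dec ((v ∈? S) ×-dec any? (λ w → (w ∈? Q) ×-dec R? w v))

  grow : Subset n → Subset n
  grow Q = fromDec (one-step? Q)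

  reached : ℕ → Subset n
  reached zero    = fromDec (_≟ u)
  reached (suc k) = grow (reached k)

  Closed : Subset n → Set
  Closed Q = ∀ {w v} → w ∈ Q → v ∈ S → R w v → v ∈ Q

  ⊆-grow : ∀ Q → Q ⊆ grow Q
  ⊆-grow Q x∈Q = ∈-fromDec⁺ (one-step? Q) (inj₁ x∈Q)

  closed⇒grow⊆ : ∀ Q → Closed Q → grow Q ⊆ Q
  closed⇒grow⊆ Q closed x∈ with ∈-fromDec⁻ (one-step? Q) x∈
  ... | inj₁ x∈Q                 = x∈Q
  ... | inj₂ (x∈S , w , w∈Q , r) = closed w∈Q x∈S r

  grow⊆⇒closed : ∀ Q → grow Q ⊆ Q → Closed Q
  grow⊆⇒closed Q grow⊆ w∈Q v∈S r = grow⊆ (∈-fromDec⁺ (one-step? Q) (inj₂ (v∈S , _ , w∈Q , r)))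

  u∈reached : ∀ k → u ∈ reached k
  u∈reached zero    = ∈-fromDec⁺ (_≟ u) refl
  u∈reached (suc k) = ⊆-grow _ (u∈reached k)

  reached-sound : u ∈ S → ∀ k {v} → v ∈ reached k → Reach v
  reached-sound u∈S zero v∈ with ∈-fromDec⁻ (_≟ u) v∈
  ... | refl = stop u∈S
  reached-sound u∈S (suc k) v∈ with ∈-fromDec⁻ (one-step? (reached k)) v∈
  ... | inj₁ v∈′                 = reached-sound u∈S k v∈′
  ... | inj₂ (v∈S , w , w∈ , r) = walk-snoc (reached-sound u∈S k w∈) r v∈S

  closed-or-growing : ∀ k → Closed (reached k) ⊎ k < ∣ reached k ∣
  closed-or-growing zero =
    inj₂ (subst (_< ∣ reached zero ∣) (∣⊥∣≡0 n) (p⊂q⇒∣p∣<∣q∣ (⊥⊆ , u , u∈reached zero , ∉⊥)))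
  closed-or-growing (suc k) with grow (reached k) ⊆? reached k
  ... | yes grow⊆ =
    inj₁ (subst Closed (⊆-antisym (⊆-grow _) grow⊆) (grow⊆⇒closed _ grow⊆))
  ... | no grow⊈ with closed-or-growing k | ⊈⇒∃ _ _ grow⊈
  ... | inj₁ closed | _ = ⊥-elim (grow⊈ (closed⇒grow⊆ _ closed))
  ... | inj₂ k<∣Q∣ | x , x∈ , x∉ =
    inj₂ (<-≤-trans (s≤s k<∣Q∣) (p⊂q⇒∣p∣<∣q∣ (⊆-grow _ , x , x∈ , x∉)))

  reached-closed : Closed (reached n)
  reached-closed with closed-or-growing n
  ... | inj₁ closed = closed
  ... | inj₂ n<∣Q∣  = ⊥-elim (<-irrefl refl (<-≤-trans n<∣Q∣ (∣p∣≤n (reached n))))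

  reached-complete : ∀ {a b} → Walk (_∈ S) R a b → a ∈ reached n → b ∈ reached n
  reached-complete (stop _)     a∈ = a∈
  reached-complete (step _ r w) a∈ = reached-complete w (reached-closed a∈ (walk-source w) r)

  reach? : ∀ v → Dec (Reach v)
  reach? v with u ∈? S | v ∈? reached n
  ... | no u∉S | _      = no λ w → u∉S (walk-source w)
  ... | yes u∈S | yes v∈ = yes (reached-sound u∈S n v∈)
  ... | yes _   | no v∉  = no λ w → v∉ (reached-complete w (u∈reached n))

walk? : ∀ {n} (S : Subset n) {R : Fin n → Fin n → Set} → (∀ u v → Dec (R u v)) →
        ∀ u v → Dec (Walk (_∈ S) R u v)
walk? S R? u = Reachability.reach? S R? u

adj? : ∀ {n} (H : SubG n) u v → Dec (Adj H u v)
adj? H u v = lookup (lookup (E H) u) v Bool.≟ true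

module _ {n : ℕ} (G : SubG n) (W : Subset n) where

  private
    InducedAdj : Fin n → Fin n → Set
    InducedAdj u v = u ∈ W × v ∈ W × Adj G u v

    induced-adj? : ∀ u v → Dec (InducedAdj u v)
    induced-adj? u v = (u ∈? W) ×-dec ((v ∈? W) ×-dec adj? G u v)

    lookup-induced : ∀ u v →
      lookup (lookup (tabulate λ u → tabulate λ v → does (induced-adj? u v)) u) v ≡ does (induced-adj? u v)
    lookup-induced u v =
      trans (cong (λ row → lookup row v) (lookup∘tabulate _ u)) (lookup∘tabulate _ v)

  induced : SubG n
  induced = subG W (tabulate λ u → tabulate λ v → does (induced-adj? u v))

  induced-adj⁺ : ∀ {u v} → u ∈ W → v ∈ W → Adj G u v → Adj induced u v
  induced-adj⁺ {u} {v} u∈ v∈ a = trans (lookup-induced u v) (dec-true (induced-adj? u v) (u∈ , v∈ , a))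

  induced-adj⁻ : ∀ {u v} → Adj induced u v → u ∈ W × v ∈ W × Adj G u v
  induced-adj⁻ {u} {v} a = does⇒witness (induced-adj? u v) (trans (sym (lookup-induced u v)) a)

  induced-wellFormed : WellFormed G → WellFormed induced
  induced-wellFormed (_ , sym-G , loopless) =
    (λ u v a → let (u∈ , v∈ , _) = induced-adj⁻ a in u∈ , v∈) ,
    (λ u v a → let (u∈ , v∈ , a′) = induced-adj⁻ a in induced-adj⁺ v∈ u∈ (sym-G u v a′)) ,
    (λ u a → loopless u (proj₂ (proj₂ (induced-adj⁻ a))))

  induced-≼ : WellFormed G → W ⊆ V G → induced ≼ G
  induced-≼ wf W⊆V = induced-wellFormed wf , W⊆V , λ u v a → proj₂ (proj₂ (induced-adj⁻ a))

module _ {n : ℕ} where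

  ≼-antisym : {D D′ : SubG n} → D ≼ D′ → D′ ≼ D → D ≡ D′
  ≼-antisym {subG V₁ E₁} {subG V₂ E₂} (_ , V₁⊆V₂ , E₁⊆E₂) (_ , V₂⊆V₁ , E₂⊆E₁) =
    cong₂ subG (⊆-antisym V₁⊆V₂ V₂⊆V₁) (matrix-ext λ u v → ⇔→≡ (mk⇔ (E₁⊆E₂ u v) (E₂⊆E₁ u v)))
    where
    vec-ext : ∀ {A : Set} {xs ys : Vec A n} → (∀ i → lookup xs i ≡ lookup ys i) → xs ≡ ys
    vec-ext {xs = xs} {ys} pointwise =
      trans (sym (tabulate∘lookup xs)) (trans (tabulate-cong pointwise) (tabulate∘lookup ys))
    matrix-ext : ∀ {M N : Vec (Vec Bool.Bool n) n} →
                 (∀ u v → lookup (lookup M u) v ≡ lookup (lookup N u) v) → M ≡ N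
    matrix-ext pointwise = vec-ext λ u → vec-ext (pointwise u)

  ≼-trans : {D D′ D″ : SubG n} → D ≼ D′ → D′ ≼ D″ → D ≼ D″
  ≼-trans (wf , V⊆V′ , E⊆E′) (_ , V′⊆V″ , E′⊆E″) =
    wf , (λ x∈ → V′⊆V″ (V⊆V′ x∈)) , λ u v a → E′⊆E″ u v (E⊆E′ u v a)

disconnected? : ∀ {n} (G : SubG n) (S : Subset n) → Dec (DisconnectedOn G S)
disconnected? G S = any? λ u → any? λ v → (u ∈? S) ×-dec ((v ∈? S) ×-dec ¬? (walk? S (adj? G) u v))

x∈p-y⁻ : ∀ {n} {x y : Fin n} {p : Subset n} → x ∈ p - y → x ∈ p × x ≢ y
x∈p-y⁻ {p = p} x∈ = let (x∈p , x∉⁅y⁆) = x∈p─q⁻ p _ x∈ in x∈p , x∉⁅y⁆⇒x≢y x∉⁅y⁆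

module _ {A : Set} {P Q : A → Set} {R : A → A → Set}
         (propagate : ∀ {x y} → P x → P y → R x y → Q x → Q y) where

  chain-last : ∀ {x y} xs → All P (x ∷ xs) → Chain R (x ∷ xs ++ y ∷ []) → Q x →
               ∃ λ z → z ∈ₗ x ∷ xs × Q z × R z y
  chain-last []        _                  (r , _)  q = _ , here refl , q , r
  chain-last (_ ∷ xs) (p ∷ ps@(p′ ∷ _)) (r , rs) q with chain-last xs ps rs (propagate p p′ r q)
  ... | z , z∈ , qz , rz = z , there z∈ , qz , rz

AdjT-sym : ∀ {n} {x y : TVert n} → AdjT x y → AdjT y x
AdjT-sym {x = inj₁ _} {inj₂ _} X⊆D = X⊆D
AdjT-sym {x = inj₂ _} {inj₁ _} X⊆D = X⊆D

-- W is X together with some of the components of G − X, at least one of them.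
record Side {n : ℕ} (G : SubG n) (X W : Subset n) : Set where
  field
    W⊆V          : W ⊆ V G
    X⊆W          : X ⊆ W
    closed       : ∀ {a w} → a ∈ W → a ∉ X → Adj G a w → w ∈ W
    inner-vertex : ∃ λ a → a ∈ W × a ∉ X

shrink : ∀ {a b m} → a < b → b ≤ suc m → a ≤ m
shrink a<b b≤ = ≤-pred (≤-trans a<b b≤)

module _ (t : ℕ) {n : ℕ} where

  TWalk : SubG n → TVert n → TVert n → Set
  TWalk G = Walk (InT t G) AdjT

  separator? : (G : SubG n) → Dec (∃ (Separator t G))
  separator? G = anySubset? λ X → (X ⊆? V G) ×-dec ((∣ X ∣ ≟ℕ t) ×-dec disconnected? G (V G ─ X))

  t-sets-⊆⇒≡ : ∀ {K X : Subset n} → ∣ K ∣ ≡ t → ∣ X ∣ ≡ t → K ⊆ X → K ≡ X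
  t-sets-⊆⇒≡ ∣K∣≡t ∣X∣≡t K⊆X = p⊆q∧∣q∣≤∣p∣⇒p≡q K⊆X (≤-reflexive (trans ∣X∣≡t (sym ∣K∣≡t)))

  candidate-large : ∀ {G D : SubG n} → BlockCandidate t G D → t < ∣ V D ∣
  candidate-large (_ , inj₁ (∣V∣≡t+1 , _)) = ≤-reflexive (sym ∣V∣≡t+1)
  candidate-large (_ , inj₂ (t+1<∣V∣ , _)) = <⇒≤ t+1<∣V∣

  candidate-⊈ : ∀ {G D : SubG n} → BlockCandidate t G D → ∀ X → ∣ X ∣ ≤ t → ∃ λ a → a ∈ V D × a ∉ X
  candidate-⊈ {G} {D} D-cand X ∣X∣≤t = ⊈⇒∃ (V D) X λ V⊆X →
    <-irrefl refl (<-≤-trans (candidate-large {G} {D} D-cand) (≤-trans (p⊆q⇒∣p∣≤∣q∣ V⊆X) ∣X∣≤t))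

  candidate-connected : ∀ {G D : SubG n} → BlockCandidate t G D → ∀ X → ∣ X ∣ ≤ t →
                        ∀ {a b} → a ∈ V D → a ∉ X → b ∈ V D → b ∉ X → Walk (_∈ V G ─ X) (Adj G) a b
  candidate-connected {G} {D} ((_ , V⊆ , E⊆) , inj₁ (_ , complete)) X _ {a} {b} a∈D a∉X b∈D b∉X with a ≟ b
  ... | yes refl = stop (x∈p∧x∉q⇒x∈p─q (V⊆ a∈D) a∉X)
  ... | no a≢b   = step (x∈p∧x∉q⇒x∈p─q (V⊆ a∈D) a∉X) (E⊆ a b (complete a b a∈D b∈D a≢b))
                        (stop (x∈p∧x∉q⇒x∈p─q (V⊆ b∈D) b∉X))
  candidate-connected {G} {D} ((_ , V⊆ , E⊆) , inj₂ (_ , connected)) X ∣X∣≤t {a} {b} a∈D a∉X b∈D b∉X =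
    walk-map to-G (λ {x} {y} → E⊆ x y)
      (connected (X ∩ V D) (λ x∈ → proj₂ (x∈p∩q⁻ X (V D) x∈)) (s≤s (≤-trans (∣p∩q∣≤∣p∣ X (V D)) ∣X∣≤t))
                 a b (to-D a∈D a∉X) (to-D b∈D b∉X))
    where
    to-D : ∀ {x} → x ∈ V D → x ∉ X → x ∈ V D ─ (X ∩ V D)
    to-D x∈D x∉X = x∈p∧x∉q⇒x∈p─q x∈D λ x∈ → x∉X (proj₁ (x∈p∩q⁻ X (V D) x∈))
    to-G : ∀ {x} → x ∈ V D ─ (X ∩ V D) → x ∈ V G ─ X
    to-G x∈ = let (x∈D , x∉X∩D) = x∈p─q⁻ (V D) (X ∩ V D) x∈ in
      x∈p∧x∉q⇒x∈p─q (V⊆ x∈D) λ x∈X → x∉X∩D (x∈p∩q⁺ (x∈X , x∈D))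

  module SideProperties {G : SubG n} (wf : WellFormed G) (cl : Cleavage t G)
                        {X : Subset n} (X-sep : Separator t G X) {W : Subset n} (side : Side G X W) where
    open Side side

    G↾W : SubG n
    G↾W = induced G W

    sym-G : ∀ {x y} → Adj G x y → Adj G y x
    sym-G {x} {y} = proj₁ (proj₂ wf) x y

    X-clique : Clique G X
    X-clique = proj₂ cl X X-sep

    ─-mono : ∀ {Y x} → x ∈ W ─ Y → x ∈ V G ─ Y
    ─-mono {Y} x∈ = let (x∈W , x∉Y) = x∈p─q⁻ W Y x∈ in x∈p∧x∉q⇒x∈p─q (W⊆V x∈W) x∉Y

    WalkIn : Subset n → Fin n → Fin n → Set
    WalkIn Y = Walk (_∈ W ─ Y) (Adj G↾W)

    -- A walk can leave W only through the clique X, so every excursion outside W is shortcut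
    -- by an edge of X.
    reroute : ∀ {Y a b} → Walk (_∈ V G ─ Y) (Adj G) a b → b ∈ W →
              (a ∈ W → WalkIn Y a b) × (a ∉ W → ∃ λ x → x ∈ X × WalkIn Y x b)
    reroute {Y} (stop a∈) b∈W =
      (λ _ → stop (x∈p∧x∉q⇒x∈p─q b∈W (proj₂ (x∈p─q⁻ (V G) Y a∈)))) , (λ b∉W → ⊥-elim (b∉W b∈W))
    reroute {Y} {a} (step {y = a′} a∈ r w) b∈W = from-inside , from-outside
      where
      rest = reroute w b∈W
      a∉Y = proj₂ (x∈p─q⁻ (V G) Y a∈)

      from-inside : a ∈ W → WalkIn Y a _
      from-inside a∈W with a′ ∈? W
      ... | yes a′∈W = step (x∈p∧x∉q⇒x∈p─q a∈W a∉Y) (induced-adj⁺ G W a∈W a′∈W r) (proj₁ rest a′∈W)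
      ... | no a′∉W with a ∈? X
      ... | no a∉X = ⊥-elim (a′∉W (closed a∈W a∉X r))
      ... | yes a∈X with proj₂ rest a′∉W
      ... | x , x∈X , wₓ with a ≟ x
      ... | yes refl = wₓ
      ... | no a≢x   = step (x∈p∧x∉q⇒x∈p─q a∈W a∉Y)
                            (induced-adj⁺ G W a∈W (X⊆W x∈X) (X-clique a x a∈X x∈X a≢x)) wₓ

      from-outside : a ∉ W → ∃ λ x → x ∈ X × WalkIn Y x _
      from-outside a∉W with a′ ∈? W
      ... | no a′∉W = proj₂ rest a′∉W
      ... | yes a′∈W with a′ ∈? X
      ... | yes a′∈X = a′ , a′∈X , proj₁ rest a′∈W
      ... | no a′∉X  = ⊥-elim (a∉W (closed a′∈W a′∉X (sym-G r)))

    walk-into-side : ∀ {Y a b} → Walk (_∈ V G ─ Y) (Adj G) a b → a ∈ W → b ∈ W → WalkIn Y a b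
    walk-into-side w a∈W b∈W = proj₁ (reroute w b∈W) a∈W

    separator-lift : ∀ {Y} → Separator t G↾W Y → Separator t G Y
    separator-lift {Y} (Y⊆W , ∣Y∣≡t , a , b , a∈ , b∈ , a↮b) =
      (λ y∈ → W⊆V (Y⊆W y∈)) , ∣Y∣≡t , a , b , ─-mono a∈ , ─-mono b∈ ,
      λ w → a↮b (walk-into-side w (p─q⊆p W Y a∈) (p─q⊆p W Y b∈))

    side-cleavage : Cleavage t G↾W
    side-cleavage = (side-large , side-connected) , λ Y Y-sep u v u∈ v∈ u≢v →
      induced-adj⁺ G W (proj₁ Y-sep u∈) (proj₁ Y-sep v∈) (proj₂ cl Y (separator-lift Y-sep) u v u∈ v∈ u≢v)
      where
      side-large : t < ∣ W ∣
      side-large = let (a , a∈W , a∉X) = inner-vertex in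
        subst (_< ∣ W ∣) (proj₁ (proj₂ X-sep)) (p⊂q⇒∣p∣<∣q∣ (X⊆W , a , a∈W , a∉X))
      side-connected : ∀ Y → Y ⊆ W → ∣ Y ∣ < t → ConnectedOn G↾W (W ─ Y)
      side-connected Y Y⊆W ∣Y∣<t a b a∈ b∈ =
        walk-into-side (proj₂ (proj₁ cl) Y (λ y∈ → W⊆V (Y⊆W y∈)) ∣Y∣<t a b (─-mono a∈) (─-mono b∈))
                       (p─q⊆p W Y a∈) (p─q⊆p W Y b∈)

    clique-restrict : ∀ {K} → K ⊆ W → Clique G K → Clique G↾W K
    clique-restrict K⊆W K-clique u v u∈ v∈ u≢v = induced-adj⁺ G W (K⊆W u∈) (K⊆W v∈) (K-clique u v u∈ v∈ u≢v)

    side-wellFormed : WellFormed G↾W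
    side-wellFormed = induced-wellFormed G W wf

    side-≼ : G↾W ≼ G
    side-≼ = induced-≼ G W wf W⊆V

    walk-avoiding-X-stays : ∀ {a v} → Walk (_∈ V G ─ X) (Adj G) a v → a ∈ W → v ∈ W
    walk-avoiding-X-stays (stop _)       a∈W = a∈W
    walk-avoiding-X-stays (step a∈ r w) a∈W = walk-avoiding-X-stays w (closed a∈W (proj₂ (x∈p─q⁻ (V G) X a∈)) r)

    candidate⊆side : ∀ {D a} → BlockCandidate t G D → a ∈ V D → a ∈ W → a ∉ X → V D ⊆ W
    candidate⊆side {D} D-cand a∈D a∈W a∉X {v} v∈D with v ∈? X
    ... | yes v∈X = X⊆W v∈X
    ... | no v∉X  = walk-avoiding-X-stays
      (candidate-connected {G} {D} D-cand X (≤-reflexive (proj₁ (proj₂ X-sep))) a∈D a∉X v∈D v∉X) a∈W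

    block-restrict : ∀ {D} → Block t G D → V D ⊆ W → Block t G↾W D
    block-restrict {D} (((D-wf , _ , E⊆) , shape) , maximal) D⊆W = (D≼G↾W , shape) , λ D′ D′-cand →
      maximal D′ (≼-trans {D = D′} {D′ = G↾W} {D″ = G} (proj₁ D′-cand) side-≼ , proj₂ D′-cand)
      where
      D≼G↾W : D ≼ G↾W
      D≼G↾W = D-wf , D⊆W , λ u v a →
        induced-adj⁺ G W (D⊆W (proj₁ (proj₁ D-wf u v a))) (D⊆W (proj₂ (proj₁ D-wf u v a))) (E⊆ u v a)

    block-lift : ∀ {D} → Block t G↾W D → Block t G D
    block-lift {D} ((D≼G↾W , shape) , maximal) = D-cand , λ D′ D′-cand D≼D′ →
      maximal D′ (D′≼G↾W {D′} D′-cand D≼D′ , proj₂ D′-cand) D≼D′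
      where
      D-cand : BlockCandidate t G D
      D-cand = ≼-trans {D = D} {D′ = G↾W} {D″ = G} D≼G↾W side-≼ , shape
      D′≼G↾W : ∀ {D′} → BlockCandidate t G D′ → D ≼ D′ → D′ ≼ G↾W
      D′≼G↾W {D′} D′-cand@((D′-wf , _ , E′⊆) , _) (_ , D⊆D′ , _) = D′-wf , D′⊆W , λ u v a →
        induced-adj⁺ G W (D′⊆W (proj₁ (proj₁ D′-wf u v a))) (D′⊆W (proj₂ (proj₁ D′-wf u v a))) (E′⊆ u v a)
        where
        D′⊆W : V D′ ⊆ W
        D′⊆W = let (a , a∈D , a∉X) = candidate-⊈ {G} {D} D-cand X (≤-reflexive (proj₁ (proj₂ X-sep))) in
          candidate⊆side {D′} D′-cand (D⊆D′ a∈D) (proj₁ (proj₂ D≼G↾W) a∈D) a∉X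

    T-walk-lift : ∀ {x y} → TWalk G↾W x y → TWalk G x y
    T-walk-lift = walk-map lift-vertex (λ r → r)
      where
      lift-vertex : ∀ {z} → InT t G↾W z → InT t G z
      lift-vertex {inj₁ D} = block-lift {D}
      lift-vertex {inj₂ Y} = separator-lift

  module Component {G : SubG n} (wf : WellFormed G) {X : Subset n} (X⊆V : X ⊆ V G)
                   (w₀ : Fin n) (w₀∈ : w₀ ∈ V G ─ X) where

    Reach : Fin n → Set
    Reach = Walk (_∈ V G ─ X) (Adj G) w₀

    reach? : ∀ v → Dec (Reach v)
    reach? = walk? (V G ─ X) (adj? G) w₀

    reach-∉X : ∀ {v} → Reach v → v ∉ X
    reach-∉X r = proj₂ (x∈p─q⁻ (V G) X (walk-target r))

    In-inner : Fin n → Set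
    In-inner v = v ∈ X ⊎ Reach v

    in-inner? : ∀ v → Dec (In-inner v)
    in-inner? v = (v ∈? X) ⊎-dec reach? v

    inner : Subset n
    inner = fromDec in-inner?

    In-outer : Fin n → Set
    In-outer v = v ∈ V G × ¬ Reach v

    in-outer? : ∀ v → Dec (In-outer v)
    in-outer? v = (v ∈? V G) ×-dec ¬? (reach? v)

    outer : Subset n
    outer = fromDec in-outer?

    X⊆inner : X ⊆ inner
    X⊆inner x∈X = ∈-fromDec⁺ in-inner? (inj₁ x∈X)

    reach⇒inner : ∀ {v} → Reach v → v ∈ inner
    reach⇒inner r = ∈-fromDec⁺ in-inner? (inj₂ r)

    inner∖X⇒reach : ∀ {v} → v ∈ inner → v ∉ X → Reach v
    inner∖X⇒reach v∈ v∉X with ∈-fromDec⁻ in-inner? v∈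
    ... | inj₁ v∈X = ⊥-elim (v∉X v∈X)
    ... | inj₂ r   = r

    inner∩outer⊆X : ∀ {v} → v ∈ inner → v ∈ outer → v ∈ X
    inner∩outer⊆X {v} v∈inner v∈outer with v ∈? X
    ... | yes v∈X = v∈X
    ... | no v∉X  = ⊥-elim (proj₂ (∈-fromDec⁻ in-outer? v∈outer)
                                  (inner∖X⇒reach v∈inner v∉X))

    inner-side : Side G X inner
    inner-side = record
      { W⊆V          = λ v∈ → [ X⊆V , (λ r → p─q⊆p (V G) X (walk-target r)) ]′
                                (∈-fromDec⁻ in-inner? v∈)
      ; X⊆W          = X⊆inner
      ; closed       = closed
      ; inner-vertex = w₀ , reach⇒inner (stop w₀∈) , proj₂ (x∈p─q⁻ (V G) X w₀∈)
      }
      where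
      closed : ∀ {a w} → a ∈ inner → a ∉ X → Adj G a w → w ∈ inner
      closed {a} {w} a∈ a∉X r with w ∈? X
      ... | yes w∈X = X⊆inner w∈X
      ... | no w∉X  = reach⇒inner
        (walk-snoc (inner∖X⇒reach a∈ a∉X) r (x∈p∧x∉q⇒x∈p─q (proj₂ (proj₁ wf a w r)) w∉X))

    outer-side : ∀ {v} → v ∈ V G ─ X → ¬ Reach v → Side G X outer
    outer-side {v} v∈ v-unreached = record
      { W⊆V          = λ u∈ → proj₁ (∈-fromDec⁻ in-outer? u∈)
      ; X⊆W          = λ x∈X → ∈-fromDec⁺ in-outer? (X⊆V x∈X , λ r → reach-∉X r x∈X)
      ; closed       = closed
      ; inner-vertex = v , ∈-fromDec⁺ in-outer? (p─q⊆p (V G) X v∈ , v-unreached) , proj₂ (x∈p─q⁻ (V G) X v∈)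
      }
      where
      closed : ∀ {a w} → a ∈ outer → a ∉ X → Adj G a w → w ∈ outer
      closed {a} {w} a∈ a∉X r with ∈-fromDec⁻ in-outer? a∈
      ... | a∈V , a-unreached = ∈-fromDec⁺ in-outer? (proj₂ (proj₁ wf a w r) ,
        λ rw → a-unreached (walk-snoc rw (proj₁ (proj₂ wf) a w r) (x∈p∧x∉q⇒x∈p─q a∈V a∉X)))

    candidate-in-a-side : ∀ {D} → BlockCandidate t G D → ∣ X ∣ ≤ t → V D ⊆ inner ⊎ V D ⊆ outer
    candidate-in-a-side {D} D-cand ∣X∣≤t with candidate-⊈ {G} {D} D-cand X ∣X∣≤t
    ... | a , a∈D , a∉X with reach? a
    ... | yes ra = inj₁ λ {v} v∈D → case-X v λ v∉X →
            reach⇒inner (ra ◅◅ candidate-connected {G} {D} D-cand X ∣X∣≤t a∈D a∉X v∈D v∉X)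
      where
      case-X : ∀ v → (v ∉ X → v ∈ inner) → v ∈ inner
      case-X v f with v ∈? X
      ... | yes v∈X = X⊆inner v∈X
      ... | no v∉X  = f v∉X
    ... | no a-unreached = inj₂ λ {v} v∈D → ∈-fromDec⁺ in-outer? (proj₁ (proj₂ (proj₁ D-cand)) v∈D ,
            λ rv → a-unreached (rv ◅◅ candidate-connected {G} {D} D-cand X ∣X∣≤t v∈D (reach-∉X rv) a∈D a∉X))

    clique-in-a-side : ∀ {K} → K ⊆ V G → Clique G K → K ⊆ inner ⊎ K ⊆ outer
    clique-in-a-side {K} K⊆V K-clique with any? (λ k → (k ∈? K) ×-dec reach? k)
    ... | yes (k , k∈K , rk) = inj₁ K⊆inner
      where
      K⊆inner : K ⊆ inner
      K⊆inner {v} v∈K with v ∈? X | k ≟ v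
      ... | yes v∈X | _        = X⊆inner v∈X
      ... | no _    | yes refl = reach⇒inner rk
      ... | no _    | no k≢v   = Side.closed inner-side (reach⇒inner rk) (reach-∉X rk) (K-clique k v k∈K v∈K k≢v)
    ... | no none-reached = inj₂ λ {v} v∈K → ∈-fromDec⁺ in-outer? (K⊆V v∈K , λ rv → none-reached (v , v∈K , rv))

  module Split {G : SubG n} (wf : WellFormed G) (cl : Cleavage t G)
               {X : Subset n} (X-sep : Separator t G X) where

    private
      separated = proj₂ (proj₂ X-sep)
      u′        = proj₁ separated
      v′        = proj₁ (proj₂ separated)
      u′∈       = proj₁ (proj₂ (proj₂ separated))
      v′∈       = proj₁ (proj₂ (proj₂ (proj₂ separated)))
      u′↮v′     = proj₂ (proj₂ (proj₂ (proj₂ separated)))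

    open Component {G} wf (proj₁ X-sep) u′ u′∈ public

    outer-side′ : Side G X outer
    outer-side′ = outer-side v′∈ u′↮v′

    inner-smaller : ∣ inner ∣ < ∣ V G ∣
    inner-smaller = p⊂q⇒∣p∣<∣q∣ (Side.W⊆V inner-side , v′ , p─q⊆p (V G) X v′∈ , v′∉inner)
      where
      v′∉inner : v′ ∉ inner
      v′∉inner v′∈inner = u′↮v′ (inner∖X⇒reach v′∈inner (proj₂ (x∈p─q⁻ (V G) X v′∈)))

    outer-smaller : ∣ outer ∣ < ∣ V G ∣
    outer-smaller = p⊂q⇒∣p∣<∣q∣ (Side.W⊆V outer-side′ , u′ , p─q⊆p (V G) X u′∈ ,
                                 λ u′∈outer → proj₂ (∈-fromDec⁻ in-outer? u′∈outer) (stop u′∈))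

    candidate-split : ∀ {D} → BlockCandidate t G D → V D ⊆ inner ⊎ V D ⊆ outer
    candidate-split {D} D-cand = candidate-in-a-side {D} D-cand (≤-reflexive (proj₁ (proj₂ X-sep)))

  complete-of-order-t+1 : ∀ {G : SubG n} → WellFormed G → Connected t G → ∣ V G ∣ ≡ suc t →
                          ∀ u v → u ∈ V G → v ∈ V G → u ≢ v → Adj G u v
  complete-of-order-t+1 {G} (_ , _ , loopless) (_ , connected) ∣V∣≡t+1 u v u∈ v∈ u≢v =
    first-edge (connected Y Y⊆V ∣Y∣<t u v (x∈p∧x∉q⇒x∈p─q u∈ u∉Y) (x∈p∧x∉q⇒x∈p─q v∈ v∉Y))
    where
    Y : Subset n
    Y = V G - u - v
    Y⊆V : Y ⊆ V G
    Y⊆V y∈ = p─q⊆p _ _ (p─q⊆p _ _ y∈)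
    ∣Y∣<t : ∣ Y ∣ < t
    ∣Y∣<t = <-≤-trans (x∈p⇒∣p-x∣<∣p∣ (x∈p∧x≢y⇒x∈p-y v∈ λ v≡u → u≢v (sym v≡u)))
                      (≤-pred (≤-trans (x∈p⇒∣p-x∣<∣p∣ u∈) (≤-reflexive ∣V∣≡t+1)))
    u∉Y : u ∉ Y
    u∉Y u∈Y = proj₂ (x∈p-y⁻ (proj₁ (x∈p-y⁻ u∈Y))) refl
    v∉Y : v ∉ Y
    v∉Y v∈Y = proj₂ (x∈p-y⁻ v∈Y) refl
    -- G − Y has vertex set {u, v}, so the first step of a walk from u to v is the edge uv.
    first-edge : Walk (_∈ V G ─ Y) (Adj G) u v → Adj G u v
    first-edge (stop _) = ⊥-elim (u≢v refl)
    first-edge (step {y = w} _ uw rest) with w ≟ u | w ≟ v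
    ... | yes refl | _        = ⊥-elim (loopless u uw)
    ... | no _     | yes refl = uw
    ... | no w≢u   | no w≢v   = let (w∈V , w∉Y) = x∈p─q⁻ (V G) Y (walk-source rest) in
      ⊥-elim (w∉Y (x∈p∧x≢y⇒x∈p-y (x∈p∧x≢y⇒x∈p-y w∈V w≢u) w≢v))

  module NoSeparator {G : SubG n} (wf : WellFormed G) (cl : Cleavage t G)
                     (no-sep : ¬ ∃ (Separator t G)) where

    self-≼ : G ≼ G
    self-≼ = wf , (λ x∈ → x∈) , λ _ _ a → a

    self-candidate : BlockCandidate t G G
    self-candidate with ∣ V G ∣ ≟ℕ suc t
    ... | yes ∣V∣≡t+1 = self-≼ , inj₁ (∣V∣≡t+1 , complete-of-order-t+1 {G} wf (proj₁ cl) ∣V∣≡t+1)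
    ... | no ∣V∣≢t+1  = self-≼ , inj₂ (≤∧≢⇒< (proj₁ (proj₁ cl)) (λ eq → ∣V∣≢t+1 (sym eq)) , connected)
      where
      connected : ∀ Y → Y ⊆ V G → ∣ Y ∣ < suc t → ConnectedOn G (V G ─ Y)
      connected Y Y⊆V ∣Y∣≤t with ∣ Y ∣ <? t
      ... | yes ∣Y∣<t = proj₂ (proj₁ cl) Y Y⊆V ∣Y∣<t
      ... | no ∣Y∣≮t  = λ a b a∈ b∈ → decidable-stable (walk? (V G ─ Y) (adj? G) a b) λ a↮b →
        no-sep (Y , Y⊆V , ≤-antisym (≤-pred ∣Y∣≤t) (≮⇒≥ ∣Y∣≮t) , a , b , a∈ , b∈ , a↮b)

    self-block : Block t G G
    self-block = self-candidate , λ D′ D′-cand G≼D′ → ≼-antisym G≼D′ (proj₁ D′-cand)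

    unique-block : ∀ {D} → Block t G D → D ≡ G
    unique-block D-block = proj₂ D-block G self-candidate (proj₁ (proj₁ D-block))

  clique⊆block′ : ∀ m (G : SubG n) → ∣ V G ∣ ≤ m → WellFormed G → Cleavage t G →
                  ∀ {K} → K ⊆ V G → Clique G K → ∃ λ D → Block t G D × K ⊆ V D
  clique⊆block′ zero    G ∣V∣≤0 _ cl _ _ = ⊥-elim (n≮0 (<-≤-trans (proj₁ (proj₁ cl)) ∣V∣≤0))
  clique⊆block′ (suc m) G ∣V∣≤ wf cl {K} K⊆V K-clique with separator? G
  ... | no no-sep       = G , NoSeparator.self-block {G} wf cl no-sep , K⊆V
  ... | yes (X , X-sep) =
    [ in-side inner-side inner-smaller , in-side outer-side′ outer-smaller ]′ (clique-in-a-side K⊆V K-clique)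
    where
    open Split {G} wf cl X-sep
    in-side : ∀ {W} → Side G X W → ∣ W ∣ < ∣ V G ∣ → K ⊆ W → ∃ λ D → Block t G D × K ⊆ V D
    in-side side smaller K⊆W =
      let open SideProperties {G} wf cl X-sep side
          (D , D-block , K⊆D) = clique⊆block′ m G↾W (shrink smaller ∣V∣≤) side-wellFormed side-cleavage
                                  K⊆W (clique-restrict K⊆W K-clique)
      in D , block-lift {D} D-block , K⊆D

  shared-t-set-separates′ : ∀ m (G : SubG n) → ∣ V G ∣ ≤ m → WellFormed G → Cleavage t G →
    ∀ {D₁ D₂ K} → Block t G D₁ → Block t G D₂ → D₁ ≢ D₂ → K ⊆ V D₁ → K ⊆ V D₂ → ∣ K ∣ ≡ t →
    Separator t G K
  shared-t-set-separates′ zero G ∣V∣≤0 _ cl _ _ _ _ _ _ = ⊥-elim (n≮0 (<-≤-trans (proj₁ (proj₁ cl)) ∣V∣≤0))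
  shared-t-set-separates′ (suc m) G ∣V∣≤ wf cl {D₁} {D₂} {K} b₁ b₂ D₁≢D₂ K⊆D₁ K⊆D₂ ∣K∣≡t
    with separator? G
  ... | no no-sep = ⊥-elim (D₁≢D₂ (trans (unique-block {D₁} b₁) (sym (unique-block {D₂} b₂))))
    where open NoSeparator {G} wf cl no-sep
  ... | yes (X , X-sep) = by-sides (candidate-split {D₁} (proj₁ b₁)) (candidate-split {D₂} (proj₁ b₂))
    where
    open Split {G} wf cl X-sep
    within : ∀ {W} → Side G X W → ∣ W ∣ < ∣ V G ∣ → V D₁ ⊆ W → V D₂ ⊆ W → Separator t G K
    within side smaller D₁⊆W D₂⊆W = let open SideProperties {G} wf cl X-sep side in
      separator-lift (shared-t-set-separates′ m G↾W (shrink smaller ∣V∣≤) side-wellFormed side-cleavage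
                        (block-restrict {D₁} b₁ D₁⊆W) (block-restrict {D₂} b₂ D₂⊆W)
                        D₁≢D₂ K⊆D₁ K⊆D₂ ∣K∣≡t)
    across : K ⊆ X → Separator t G K
    across K⊆X = subst (Separator t G) (sym (t-sets-⊆⇒≡ ∣K∣≡t (proj₁ (proj₂ X-sep)) K⊆X)) X-sep
    by-sides : V D₁ ⊆ inner ⊎ V D₁ ⊆ outer → V D₂ ⊆ inner ⊎ V D₂ ⊆ outer → Separator t G K
    by-sides (inj₁ D₁⊆) (inj₁ D₂⊆) = within inner-side inner-smaller D₁⊆ D₂⊆
    by-sides (inj₂ D₁⊆) (inj₂ D₂⊆) = within outer-side′ outer-smaller D₁⊆ D₂⊆
    by-sides (inj₁ D₁⊆) (inj₂ D₂⊆) = across λ k∈ → inner∩outer⊆X (D₁⊆ (K⊆D₁ k∈)) (D₂⊆ (K⊆D₂ k∈))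
    by-sides (inj₂ D₁⊆) (inj₁ D₂⊆) = across λ k∈ → inner∩outer⊆X (D₂⊆ (K⊆D₂ k∈)) (D₁⊆ (K⊆D₁ k∈))

  blocks-linked′ : ∀ m (G : SubG n) → ∣ V G ∣ ≤ m → WellFormed G → Cleavage t G →
                   ∀ {D₁ D₂} → Block t G D₁ → Block t G D₂ → TWalk G (inj₁ D₁) (inj₁ D₂)
  blocks-linked′ zero G ∣V∣≤0 _ cl _ _ = ⊥-elim (n≮0 (<-≤-trans (proj₁ (proj₁ cl)) ∣V∣≤0))
  blocks-linked′ (suc m) G ∣V∣≤ wf cl {D₁} {D₂} b₁ b₂ with separator? G
  ... | no no-sep = subst (λ D → TWalk G (inj₁ D₁) (inj₁ D))
                          (trans (unique-block {D₁} b₁) (sym (unique-block {D₂} b₂))) (stop b₁)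
    where open NoSeparator {G} wf cl no-sep
  ... | yes (X , X-sep) = by-sides (candidate-split {D₁} (proj₁ b₁)) (candidate-split {D₂} (proj₁ b₂))
    where
    open Split {G} wf cl X-sep
    linked-within : ∀ {W} → Side G X W → ∣ W ∣ < ∣ V G ∣ →
                    ∀ {D D′} → Block t (induced G W) D → Block t (induced G W) D′ → TWalk G (inj₁ D) (inj₁ D′)
    linked-within side smaller {D} {D′} b b′ = let open SideProperties {G} wf cl X-sep side in
      T-walk-lift (blocks-linked′ m G↾W (shrink smaller ∣V∣≤) side-wellFormed side-cleavage {D} {D′} b b′)
    linked-to-X : ∀ {W} → Side G X W → ∣ W ∣ < ∣ V G ∣ →
                  ∀ {D} → Block t G D → V D ⊆ W → TWalk G (inj₁ D) (inj₂ X)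
    linked-to-X side smaller {D} b D⊆W =
      let open SideProperties {G} wf cl X-sep side
          (B , B-block , X⊆B) = clique⊆block′ m G↾W (shrink smaller ∣V∣≤) side-wellFormed side-cleavage
                                  (Side.X⊆W side) (clique-restrict (Side.X⊆W side) X-clique)
      in linked-within side smaller {D} {B} (block-restrict {D} b D⊆W) B-block
         ◅◅ step {y = inj₂ X} (block-lift {B} B-block) X⊆B (stop X-sep)
    by-sides : V D₁ ⊆ inner ⊎ V D₁ ⊆ outer → V D₂ ⊆ inner ⊎ V D₂ ⊆ outer → TWalk G (inj₁ D₁) (inj₁ D₂)
    by-sides (inj₁ D₁⊆) (inj₁ D₂⊆) = let open SideProperties {G} wf cl X-sep inner-side in
      linked-within inner-side inner-smaller {D₁} {D₂}
        (block-restrict {D₁} b₁ D₁⊆) (block-restrict {D₂} b₂ D₂⊆)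
    by-sides (inj₂ D₁⊆) (inj₂ D₂⊆) = let open SideProperties {G} wf cl X-sep outer-side′ in
      linked-within outer-side′ outer-smaller {D₁} {D₂}
        (block-restrict {D₁} b₁ D₁⊆) (block-restrict {D₂} b₂ D₂⊆)
    by-sides (inj₁ D₁⊆) (inj₂ D₂⊆) = linked-to-X inner-side inner-smaller {D₁} b₁ D₁⊆
                                     ◅◅ walk-reverse AdjT-sym (linked-to-X outer-side′ outer-smaller {D₂} b₂ D₂⊆)
    by-sides (inj₂ D₁⊆) (inj₁ D₂⊆) = linked-to-X outer-side′ outer-smaller {D₁} b₁ D₁⊆
                                     ◅◅ walk-reverse AdjT-sym (linked-to-X inner-side inner-smaller {D₂} b₂ D₂⊆)

  clique⊆block : (G : SubG n) → WellFormed G → Cleavage t G →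
                 ∀ {K} → K ⊆ V G → Clique G K → ∃ λ D → Block t G D × K ⊆ V D
  clique⊆block G = clique⊆block′ _ G ≤-refl

  shared-t-set-separates : (G : SubG n) → WellFormed G → Cleavage t G →
    ∀ {D₁ D₂ K} → Block t G D₁ → Block t G D₂ → D₁ ≢ D₂ → K ⊆ V D₁ → K ⊆ V D₂ → ∣ K ∣ ≡ t →
    Separator t G K
  shared-t-set-separates G = shared-t-set-separates′ _ G ≤-refl

  blocks-linked : (G : SubG n) → WellFormed G → Cleavage t G →
                  ∀ {D₁ D₂} → Block t G D₁ → Block t G D₂ → TWalk G (inj₁ D₁) (inj₁ D₂)
  blocks-linked G = blocks-linked′ _ G ≤-refl

  -- Here inner is X ∪ C for the component C of G − X that meets the block D₀ ⊇ X.
  module Acyclicity {G : SubG n} (wf : WellFormed G) (cl : Cleavage t G)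
                    {X : Subset n} (X-sep : Separator t G X)
                    {D₀ : SubG n} (D₀-block : Block t G D₀) (X⊆D₀ : X ⊆ V D₀) where

    private
      ∣X∣≡t = proj₁ (proj₂ X-sep)
      outside-X = candidate-⊈ {G} {D₀} (proj₁ D₀-block) X (≤-reflexive ∣X∣≡t)
      w₀        = proj₁ outside-X
      w₀∈D₀     = proj₁ (proj₂ outside-X)
      w₀∉X      = proj₂ (proj₂ outside-X)
      w₀∈       = x∈p∧x∉q⇒x∈p─q (proj₁ (proj₂ (proj₁ (proj₁ D₀-block))) w₀∈D₀) w₀∉X

    open Component {G} wf (proj₁ X-sep) w₀ w₀∈
    open SideProperties {G} wf cl X-sep inner-side

    Within : TVert n → Set
    Within (inj₁ D) = V D ⊆ inner
    Within (inj₂ Y) = Y ⊆ inner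

    D₀-within : Within (inj₁ D₀)
    D₀-within = candidate⊆side {D₀} (proj₁ D₀-block) w₀∈D₀ (reach⇒inner (stop w₀∈)) w₀∉X

    Avoiding : TVert n → Set
    Avoiding z = InT t G z × inj₂ X ≢ z

    -- A separator Y ≠ X has a vertex outside X, which drags every block containing Y into X ∪ C.
    within-step : ∀ {z z′} → Avoiding z → Avoiding z′ → AdjT z z′ → Within z → Within z′
    within-step {inj₁ D} {inj₂ Y} _ _ Y⊆D D⊆ y∈ = D⊆ (Y⊆D y∈)
    within-step {inj₂ Y} {inj₁ D} (Y-sep , X≢Y) (D-block , _) Y⊆D Y⊆ with ⊈⇒∃ Y X Y⊈X
      where
      Y⊈X : ¬ Y ⊆ X
      Y⊈X Y⊆X = X≢Y (cong inj₂ (sym (t-sets-⊆⇒≡ (proj₁ (proj₂ Y-sep)) ∣X∣≡t Y⊆X)))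
    ... | y , y∈Y , y∉X = candidate⊆side {D} (proj₁ D-block) (Y⊆D y∈Y) (Y⊆ y∈Y) y∉X
    within-step {inj₁ _} {inj₁ _} _ _ ()
    within-step {inj₂ _} {inj₂ _} _ _ ()

    inner-connected : ConnectedOn G↾W (inner ─ X)
    inner-connected a b a∈ b∈ = walk-into-side (walk-reverse sym-G (reach a∈) ◅◅ reach b∈)
                                               (p─q⊆p inner X a∈) (p─q⊆p inner X b∈)
      where
      reach : ∀ {v} → v ∈ inner ─ X → Reach v
      reach v∈ = let (v∈inner , v∉X) = x∈p─q⁻ inner X v∈ in inner∖X⇒reach v∈inner v∉X

    no-second-block : ∀ {z} → InT t G z → inj₁ D₀ ≢ z → AdjT z (inj₂ X) → Within z → Empty
    no-second-block {inj₁ D} D-block D₀≢D X⊆D D⊆inner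
      with shared-t-set-separates G↾W side-wellFormed side-cleavage
             (block-restrict {D} D-block D⊆inner) (block-restrict {D₀} D₀-block D₀-within)
             (λ D≡D₀ → D₀≢D (cong inj₁ (sym D≡D₀))) X⊆D X⊆D₀ ∣X∣≡t
    ... | _ , _ , a , b , a∈ , b∈ , a↮b = a↮b (inner-connected a b a∈ b∈)
    no-second-block {inj₂ _} _ _ ()

  T-acyclic : (G : SubG n) → WellFormed G → Cleavage t G → ¬ Cycle (InT t G) AdjT
  T-acyclic G wf cl (_ , [] , () , _)
  T-acyclic G wf cl (_ , _ ∷ [] , s≤s () , _)
  -- Whether the cycle is listed from a separator or from a block, it leaves a separator through a
  -- block D₀ and returns to it through a block z ≠ D₀ found by chain-last.
  T-acyclic G wf cl (inj₂ X , inj₁ D₀ ∷ y ∷ ys , _ , X-sep ∷ D₀-block ∷ in-T ,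
                     (X≢ ∷ D₀≢ ∷ _) , X⊆D₀ , D₀y , chain)
    with chain-last within-step ys (All.zip (in-T , All.tail X≢)) chain
           (within-step (D₀-block , All.head X≢) (All.head in-T , All.head (All.tail X≢)) D₀y D₀-within)
    where open Acyclicity {G} wf cl X-sep {D₀} D₀-block X⊆D₀
  ... | z , z∈ , z-within , zX =
    no-second-block (All.lookup in-T z∈) (All.lookup D₀≢ z∈) zX z-within
    where open Acyclicity {G} wf cl X-sep {D₀} D₀-block X⊆D₀
  T-acyclic G wf cl (inj₁ D₁ , inj₂ Y ∷ inj₁ D₀ ∷ ys , _ , D₁-block ∷ Y-sep ∷ in-T ,
                     (D₁≢ ∷ Y≢ ∷ _) , Y⊆D₁ , Y⊆D₀ , chain)
    with chain-last within-step ys (All.zip (in-T , Y≢)) chain D₀-within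
    where open Acyclicity {G} wf cl Y-sep {D₀} (All.head in-T) Y⊆D₀
  ... | z , z∈ , z-within , zD₁ =
    no-second-block D₁-block (λ D₀≡D₁ → All.head (All.tail D₁≢) (sym D₀≡D₁)) Y⊆D₁
      (within-step (All.lookup in-T z∈ , All.lookup Y≢ z∈) (D₁-block , λ ()) zD₁ z-within)
    where open Acyclicity {G} wf cl Y-sep {D₀} (All.head in-T) Y⊆D₀
  T-acyclic G wf cl (inj₂ _ , inj₂ _ ∷ _ ∷ _ , _ , _ , _ , () , _)
  T-acyclic G wf cl (inj₁ _ , inj₁ _ ∷ _ ∷ _ , _ , _ , _ , () , _)
  T-acyclic G wf cl (inj₁ _ , inj₂ _ ∷ inj₂ _ ∷ _ , _ , _ , _ , _ , () , _)

  T-nonempty : (G : SubG n) → WellFormed G → Cleavage t G → ∃ (InT t G)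
  T-nonempty G wf cl =
    let (D , D-block , _) = clique⊆block G wf cl {⊥} ⊥⊆ (λ _ _ u∈⊥ → ⊥-elim (∉⊥ u∈⊥)) in inj₁ D , D-block

  linked-to-block : (G : SubG n) → WellFormed G → Cleavage t G →
                    ∀ z → InT t G z → ∃ λ D → Block t G D × TWalk G z (inj₁ D)
  linked-to-block G wf cl (inj₁ D) D-block = D , D-block , stop D-block
  linked-to-block G wf cl (inj₂ Y) Y-sep =
    let (D , D-block , Y⊆D) = clique⊆block G wf cl (proj₁ Y-sep) (proj₂ cl Y Y-sep) in
    D , D-block , step {y = inj₁ D} Y-sep Y⊆D (stop D-block)

  T-connected : (G : SubG n) → WellFormed G → Cleavage t G → ∀ x y → InT t G x → InT t G y → TWalk G x y
  T-connected G wf cl x y x-in y-in =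
    let (D₁ , D₁-block , x⇝D₁) = linked-to-block G wf cl x x-in
        (D₂ , D₂-block , y⇝D₂) = linked-to-block G wf cl y y-in
    in x⇝D₁ ◅◅ blocks-linked G wf cl D₁-block D₂-block ◅◅ walk-reverse AdjT-sym y⇝D₂

theorem4p2 : ∀ {n : ℕ} (t : ℕ) (G : SubG n) → 1 ≤ t →
    WellFormed G → Spanning G → Cleavage t G →
    IsTree (InT t G) AdjT
theorem4p2 t G _ wf _ cl = T-nonempty t G wf cl , T-connected t G wf cl , T-acyclic t G wf cl
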